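{- Let $\mathbb F$ be a field, let $\varphi$ be an $\mathbb F^+$-gain function on $2C_4''$ with no balanced 2-cycle, and let $\psi$ be any $\mathbb F^+$-gain function on $2C_4''$. Then $A_L(2C_4'',\varphi)$ and $A_L(2C_4'',\psi)$ are projectively equivalent if and only if $\varphi$ and $\psi$ are equivalent by switching and scaling.
   Context: $2C_4''$ is a 4-cycle with each edge of one pair of opposite edges doubled. An $\mathbb F^+$-gain function: $\varphi(e^{ -1})=-\varphi(e)$; a cycle is balanced if its gain sum is $0$. Switching and scaling: $\psi=a\varphi^\eta$ with $\varphi^\eta(e)=-\eta(\mathrm{tail}\,e)+\varphi(e)+\eta(\mathrm{head}\,e)$, $\eta:V\to\mathbb F$, $a\in\mathbb F^\times$. Lift matrix $A_L(G,\psi)$: rows $V(G)\cup\{v_0\}$, columns $E(G)$, link column $\hat{\mathrm{tail}(e)}-\hat{\mathrm{head}(e)}+\psi(e)\hat v_0$. Projectively equivalent: related by elementary row operations, nonzero column scalings, and deleting/adjoining zero rows. -}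

module Defs where

open import Level using (Level; _⊔_) renaming (suc to lsuc)
open import Data.Nat using (ℕ) renaming (suc to sucℕ)
open import Data.Fin using (Fin; zero; suc; _≟_)
open import Data.Product using (Σ; ∃; _,_; _×_)
open import Relation.Nullary using (¬_; yes; no)
open import Relation.Binary.PropositionalEquality using (_≡_)
open import Relation.Binary.Construct.Closure.Equivalence using (EqClosure)
open import Algebra.Bundles using (CommutativeRing)
open import Data.Vec.Functional using (insertAt; removeAt)

record Field (c ℓ : Level) : Set (lsuc (c ⊔ ℓ)) where
  field
    commutativeRing : CommutativeRing c ℓ
  open CommutativeRing commutativeRing public
  field
    1≉0     : ¬ (1# ≈ 0#)
    inverse : ∀ x → ¬ (x ≈ 0#) → Σ Carrier λ y → (x * y) ≈ 1#

-- The graph 2C₄'' : vertices v₁..v₄ = Fin 4 (0,1,2,3), and six edges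
-- (Fin 6), each with a fixed reference orientation:
--   e₀ : v₁ → v₂,  e₁ : v₁ → v₂   (doubled edge v₁v₂)
--   e₂ : v₂ → v₃
--   e₃ : v₃ → v₄,  e₄ : v₃ → v₄   (doubled edge v₃v₄, opposite to v₁v₂)
--   e₅ : v₄ → v₁

Vertex : Set
Vertex = Fin 4

Edge : Set
Edge = Fin 6

tail : Edge → Vertex
tail zero                                   = zero
tail (suc zero)                             = zero
tail (suc (suc zero))                       = suc zero
tail (suc (suc (suc zero)))                 = suc (suc zero)
tail (suc (suc (suc (suc zero))))           = suc (suc zero)
tail (suc (suc (suc (suc (suc zero)))))     = suc (suc (suc zero))

head : Edge → Vertex
head zero                                   = suc zero
head (suc zero)                             = suc zero
head (suc (suc zero))                       = suc (suc zero)
head (suc (suc (suc zero)))                 = suc (suc (suc zero))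
head (suc (suc (suc (suc zero))))           = suc (suc (suc zero))
head (suc (suc (suc (suc (suc zero)))))     = zero

Matrix : ∀ {a} → Set a → ℕ → ℕ → Set a
Matrix A m n = Fin m → Fin n → A

module _ {c ℓ : Level} (F : Field c ℓ) where
  open Field F using (Carrier; _≈_; _+_; _*_; -_; _-_; 0#; 1#)

  -- An F⁺-gain function is determined by its values on the reference
  -- orientations; the value on a reversed edge is the negative
  -- (φ(e⁻¹) = -φ(e)).
  GainFunction : Set c
  GainFunction = Edge → Carrier

  -- The 2-cycles of 2C₄'' are e₀e₁⁻¹ and e₃e₄⁻¹; gain sums φ(e₀) - φ(e₁)
  -- and φ(e₃) - φ(e₄).
  NoBalanced2Cycle : GainFunction → Set ℓ
  NoBalanced2Cycle φ =
    ¬ ((φ zero - φ (suc zero)) ≈ 0#) ×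
    ¬ ((φ (suc (suc (suc zero))) - φ (suc (suc (suc (suc zero))))) ≈ 0#)

  switch : (Vertex → Carrier) → GainFunction → GainFunction
  switch η φ e = ((- η (tail e)) + φ e) + η (head e)

  SwitchScaleEquivalent : GainFunction → GainFunction → Set (c ⊔ ℓ)
  SwitchScaleEquivalent φ ψ =
    Σ (Vertex → Carrier) λ η → Σ Carrier λ a →
      ¬ (a ≈ 0#) × (∀ e → ψ e ≈ (a * switch η φ e))

  -- Lift matrix: rows V(G) ∪ {v₀} (rows 0..3 = v₁..v₄, row 4 = v₀),
  -- column of e = t̂ail(e) - ĥead(e) + ψ(e) v̂₀.
  vertexEntry : Vertex → Edge → Carrier
  vertexEntry v e with v ≟ tail e | v ≟ head e
  ... | yes _ | _     = 1#
  ... | no _  | yes _ = - 1#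
  ... | no _  | no _  = 0#

  liftMatrix : GainFunction → Matrix Carrier 5 6
  liftMatrix φ zero                                 e = vertexEntry zero e
  liftMatrix φ (suc zero)                           e = vertexEntry (suc zero) e
  liftMatrix φ (suc (suc zero))                     e = vertexEntry (suc (suc zero)) e
  liftMatrix φ (suc (suc (suc zero)))               e = vertexEntry (suc (suc (suc zero))) e
  liftMatrix φ (suc (suc (suc (suc zero))))         e = φ e

  SizedMatrix : ℕ → Set c
  SizedMatrix n = Σ ℕ λ m → Matrix Carrier m n

  swapIndex : ∀ {m} → Fin m → Fin m → Fin m → Fin m
  swapIndex i j k with k ≟ i | k ≟ j
  ... | yes _ | _     = j
  ... | no _  | yes _ = i
  ... | no _  | no _  = k

  rowScaleEntry : ∀ {m n} → Matrix Carrier m n → Fin m → Carrier → Matrix Carrier m n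
  rowScaleEntry M i a k l with k ≟ i
  ... | yes _ = a * M k l
  ... | no _  = M k l

  rowAddEntry : ∀ {m n} → Matrix Carrier m n → Fin m → Fin m → Carrier → Matrix Carrier m n
  rowAddEntry M i j a k l with k ≟ i
  ... | yes _ = M k l + (a * M j l)
  ... | no _  = M k l

  colScaleEntry : ∀ {m n} → Matrix Carrier m n → Fin n → Carrier → Matrix Carrier m n
  colScaleEntry M j a k l with l ≟ j
  ... | yes _ = a * M k l
  ... | no _  = M k l

  data Step {n : ℕ} : SizedMatrix n → SizedMatrix n → Set (c ⊔ ℓ) where
    same      : ∀ {m} (M N : Matrix Carrier m n) →
                (∀ i j → M i j ≈ N i j) → Step (m , M) (m , N)
    rowSwap   : ∀ {m} (M : Matrix Carrier m n) (i j : Fin m) →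
                Step (m , M) (m , λ k → M (swapIndex i j k))
    rowScale  : ∀ {m} (M : Matrix Carrier m n) (i : Fin m) (a : Carrier) →
                ¬ (a ≈ 0#) →
                Step (m , M) (m , λ k l → rowScaleEntry M i a k l)
    rowAdd    : ∀ {m} (M : Matrix Carrier m n) (i j : Fin m) (a : Carrier) →
                ¬ (i ≡ j) →
                Step (m , M) (m , λ k l → rowAddEntry M i j a k l)
    colScale  : ∀ {m} (M : Matrix Carrier m n) (j : Fin n) (a : Carrier) →
                ¬ (a ≈ 0#) →
                Step (m , M) (m , λ k l → colScaleEntry M j a k l)
    adjoinZero : ∀ {m} (M : Matrix Carrier m n) (i : Fin (sucℕ m)) →
                 Step (m , M) (sucℕ m , insertAt M i (λ _ → 0#))
    deleteZero : ∀ {m} (M : Matrix Carrier (sucℕ m) n) (i : Fin (sucℕ m)) →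
                 (∀ l → M i l ≈ 0#) →
                 Step (sucℕ m , M) (m , removeAt M i)

  ProjectivelyEquivalent : ∀ {m m' n} → Matrix Carrier m n → Matrix Carrier m' n → Set (c ⊔ ℓ)
  ProjectivelyEquivalent {m} {m'} M N = EqClosure Step (m , M) (m' , N)

-- Every elementary step of projective equivalence preserves the kernel of a matrix up to a
-- nonzero rescaling of the coordinates. The kernel of A_L(2C₄'', φ) is the space of circulations
-- of zero φ-gain; when neither 2-cycle is balanced it contains two circulations that remain
-- circulations only under a constant rescaling, so A_L(φ) and A_L(ψ) have the same kernel.
-- Testing that kernel on the cycle space shows that the gains of ψ on the three basic cycles are
-- a nonzero multiple a of those of φ, hence ψ − aφ is balanced, i.e. a coboundary, and ψ = a φ^η.
-- Conversely, switching by η adds multiples of the vertex rows to the gain row, and scaling by a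
-- scales the gain row.
module Submission where

open import Defs
open import Level using (Level; _⊔_)
open import Function.Base using (_∘_)
open import Function.Bundles using (_⇔_; mk⇔; module Equivalence)
open import Function.Construct.Identity using (⇔-id)
open import Function.Construct.Symmetry using (⇔-sym)
open import Function.Construct.Composition using (_⇔-∘_)
open import Relation.Binary.Core using (_⇒_)
open import Relation.Binary.Definitions using (Reflexive; Symmetric; Transitive)
open import Relation.Binary.Structures using (IsEquivalence)
import Relation.Binary.Construct.Closure.Equivalence as EqClosure
open import Relation.Binary.Construct.Closure.ReflexiveTransitive using (ε; _◅_; _◅◅_)
open import Relation.Binary.Construct.Closure.Symmetric using (fwd)
open import Relation.Binary.PropositionalEquality as ≡ using (_≡_)
open import Relation.Nullary using (¬_; yes; no; contradiction)
open import Algebra.Bundles using (CommutativeRing)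
open import Algebra.Solver.Ring.AlmostCommutativeRing
  using (_-Raw-AlmostCommutative⟶_; fromCommutativeRing)
open import Data.Nat as ℕ using (ℕ; zero; suc)
open import Data.Integer as ℤ using (ℤ; +_; -[1+_]; _⊖_; 0ℤ; 1ℤ; -1ℤ)
import Data.Integer.Properties as ℤ
import Data.Sign as Sign
open import Data.Maybe using (Maybe; just; nothing)
open import Data.Product using (Σ; _,_; _×_; proj₁; proj₂)
open import Data.Fin using (Fin; _≟_; punchIn; punchOut)
open import Data.Fin.Patterns using (0F; 1F; 2F; 3F; 4F; 5F)
open import Data.Fin.Properties using (punchIn-punchOut)
open import Data.Fin.Permutation.Components using (transpose; transpose-inverse)
open import Data.Vec.Functional using (insertAt; removeAt)
open import Data.Vec.Functional.Properties using (insertAt-lookup; insertAt-punchIn)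

punchIn-cases : ∀ {n p} {P : Fin (suc n) → Set p} i →
                P i → (∀ k → P (punchIn i k)) → ∀ k → P k
punchIn-cases {P = P} i Pi P-punchIn k with i ≟ k
... | yes ≡.refl = Pi
... | no i≢k     = ≡.subst P (punchIn-punchOut i≢k) (P-punchIn (punchOut i≢k))

module IntegerCoefficientSolver {c ℓ : Level} (R : CommutativeRing c ℓ) where
  open CommutativeRing R
  open import Algebra.Properties.Ring ring
    using (-0#≈0#; -‿involutive; -‿+-comm; -‿distribˡ-*; -‿distribʳ-*)
  open import Algebra.Properties.Semiring.Mult.TCOptimised semiring
    using (1+×; ×-homo-+; ×1-homo-*) renaming (_×_ to _×′_)
  open import Relation.Binary.Reasoning.Setoid setoid

  -- On 0ℤ, 1ℤ and -1ℤ this computes to 0#, 1# and - 1#, so the solver constants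
  -- con 0ℤ, con 1ℤ, con -1ℤ match those literals in goals definitionally.
  fromℤ : ℤ → Carrier
  fromℤ (+ n)      = n ×′ 1#
  fromℤ (-[1+ n ]) = - (suc n ×′ 1#)

  fromℤ-homo-neg : ∀ i → fromℤ (ℤ.- i) ≈ - fromℤ i
  fromℤ-homo-neg -[1+ n ]  = sym (-‿involutive _)
  fromℤ-homo-neg (+ zero)  = sym -0#≈0#
  fromℤ-homo-neg (+ suc n) = refl

  fromℤ-homo-⊖ : ∀ m n → fromℤ (m ⊖ n) ≈ m ×′ 1# - n ×′ 1#
  fromℤ-homo-⊖ zero    zero    = sym (trans (+-congˡ -0#≈0#) (+-identityʳ 0#))
  fromℤ-homo-⊖ (suc m) zero    = sym (trans (+-congˡ -0#≈0#) (+-identityʳ _))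
  fromℤ-homo-⊖ zero    (suc n) = sym (+-identityˡ _)
  fromℤ-homo-⊖ (suc m) (suc n) = begin
    fromℤ (suc m ⊖ suc n)              ≡⟨ ≡.cong fromℤ (ℤ.[1+m]⊖[1+n]≡m⊖n m n) ⟩
    fromℤ (m ⊖ n)                      ≈⟨ fromℤ-homo-⊖ m n ⟩
    m ×′ 1# - n ×′ 1#                  ≈⟨ +-congʳ (+-identityˡ _) ⟨
    0# + m ×′ 1# - n ×′ 1#             ≈⟨ +-congʳ (+-congʳ (-‿inverseʳ 1#)) ⟨
    1# - 1# + m ×′ 1# - n ×′ 1#        ≈⟨ +-congʳ (+-assoc 1# (- 1#) _) ⟩
    1# + (- 1# + m ×′ 1#) - n ×′ 1#    ≈⟨ +-congʳ (+-congˡ (+-comm (- 1#) _)) ⟩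
    1# + (m ×′ 1# - 1#) - n ×′ 1#      ≈⟨ +-congʳ (+-assoc 1# (m ×′ 1#) (- 1#)) ⟨
    1# + m ×′ 1# - 1# - n ×′ 1#        ≈⟨ +-assoc _ (- 1#) (- (n ×′ 1#)) ⟩
    1# + m ×′ 1# + (- 1# - n ×′ 1#)    ≈⟨ +-cong (sym (1+× m 1#)) (-‿+-comm 1# (n ×′ 1#)) ⟩
    suc m ×′ 1# - (1# + n ×′ 1#)       ≈⟨ +-congˡ (-‿cong (1+× n 1#)) ⟨
    suc m ×′ 1# - suc n ×′ 1#          ∎

  fromℤ-homo-+ : ∀ i j → fromℤ (i ℤ.+ j) ≈ fromℤ i + fromℤ j
  fromℤ-homo-+ -[1+ m ] -[1+ n ] = begin
    - (suc (suc (m ℕ.+ n)) ×′ 1#)      ≈⟨ -‿cong (1+× (suc (m ℕ.+ n)) 1#) ⟩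
    - (1# + suc (m ℕ.+ n) ×′ 1#)       ≈⟨ -‿cong (+-congˡ (×-homo-+ 1# (suc m) n)) ⟩
    - (1# + (suc m ×′ 1# + n ×′ 1#))   ≈⟨ -‿cong (+-assoc 1# _ _) ⟨
    - (1# + suc m ×′ 1# + n ×′ 1#)     ≈⟨ -‿cong (+-congʳ (+-comm 1# _)) ⟩
    - (suc m ×′ 1# + 1# + n ×′ 1#)     ≈⟨ -‿cong (+-assoc _ 1# _) ⟩
    - (suc m ×′ 1# + (1# + n ×′ 1#))   ≈⟨ -‿cong (+-congˡ (1+× n 1#)) ⟨
    - (suc m ×′ 1# + suc n ×′ 1#)      ≈⟨ -‿+-comm _ _ ⟨
    - (suc m ×′ 1#) + - (suc n ×′ 1#)  ∎
  fromℤ-homo-+ -[1+ m ] (+ n)    = trans (fromℤ-homo-⊖ n (suc m)) (+-comm _ _)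
  fromℤ-homo-+ (+ m)    -[1+ n ] = fromℤ-homo-⊖ m (suc n)
  fromℤ-homo-+ (+ m)    (+ n)    = ×-homo-+ 1# m n

  fromℤ-+◃ : ∀ n → fromℤ (Sign.+ ℤ.◃ n) ≈ n ×′ 1#
  fromℤ-+◃ n = reflexive (≡.cong fromℤ (ℤ.+◃n≡+n n))

  fromℤ--◃ : ∀ n → fromℤ (Sign.- ℤ.◃ n) ≈ - (n ×′ 1#)
  fromℤ--◃ n = trans (reflexive (≡.cong fromℤ (ℤ.-◃n≡-n n))) (fromℤ-homo-neg (+ n))

  fromℤ-homo-* : ∀ i j → fromℤ (i ℤ.* j) ≈ fromℤ i * fromℤ j
  fromℤ-homo-* (+ m)    (+ n)    = trans (fromℤ-+◃ (m ℕ.* n)) (×1-homo-* m n)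
  fromℤ-homo-* (+ m)    -[1+ n ] = begin
    fromℤ (Sign.- ℤ.◃ (m ℕ.* suc n))   ≈⟨ fromℤ--◃ (m ℕ.* suc n) ⟩
    - ((m ℕ.* suc n) ×′ 1#)            ≈⟨ -‿cong (×1-homo-* m (suc n)) ⟩
    - (m ×′ 1# * suc n ×′ 1#)          ≈⟨ -‿distribʳ-* _ _ ⟩
    m ×′ 1# * - (suc n ×′ 1#)          ∎
  fromℤ-homo-* -[1+ m ] (+ n)    = begin
    fromℤ (Sign.- ℤ.◃ (suc m ℕ.* n))   ≈⟨ fromℤ--◃ (suc m ℕ.* n) ⟩
    - ((suc m ℕ.* n) ×′ 1#)            ≈⟨ -‿cong (×1-homo-* (suc m) n) ⟩
    - (suc m ×′ 1# * n ×′ 1#)          ≈⟨ -‿distribˡ-* _ _ ⟩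
    - (suc m ×′ 1#) * n ×′ 1#          ∎
  fromℤ-homo-* -[1+ m ] -[1+ n ] = begin
    fromℤ (Sign.+ ℤ.◃ (suc m ℕ.* suc n))  ≈⟨ fromℤ-+◃ (suc m ℕ.* suc n) ⟩
    (suc m ℕ.* suc n) ×′ 1#               ≈⟨ ×1-homo-* (suc m) (suc n) ⟩
    suc m ×′ 1# * suc n ×′ 1#             ≈⟨ -‿involutive _ ⟨
    - - (suc m ×′ 1# * suc n ×′ 1#)       ≈⟨ -‿cong (-‿distribˡ-* _ _) ⟩
    - (- (suc m ×′ 1#) * suc n ×′ 1#)     ≈⟨ -‿distribʳ-* _ _ ⟩
    - (suc m ×′ 1#) * - (suc n ×′ 1#)     ∎

  ℤ⟶R : ℤ.+-*-rawRing -Raw-AlmostCommutative⟶ fromCommutativeRing R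
  ℤ⟶R = record
    { ⟦_⟧    = fromℤ
    ; +-homo = fromℤ-homo-+
    ; *-homo = fromℤ-homo-*
    ; -‿homo = fromℤ-homo-neg
    ; 0-homo = refl
    ; 1-homo = refl
    }

  fromℤ-≟ : ∀ i j → Maybe (fromℤ i ≈ fromℤ j)
  fromℤ-≟ i j with i ℤ.≟ j
  ... | yes ≡.refl = just refl
  ... | no _       = nothing

  open import Algebra.Solver.Ring ℤ.+-*-rawRing (fromCommutativeRing R) ℤ⟶R fromℤ-≟
    public using (solve; _:=_; con; _:+_; _:*_; _:-_; :-_)

module _ {c ℓ : Level} (F : Field c ℓ) where
  open Field F
  open IntegerCoefficientSolver commutativeRing
  open import Algebra.Properties.Ring ring using (x∙y⁻¹≈ε⇒x≈y; x≈y⇒x∙y⁻¹≈ε)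
  open import Algebra.Properties.Semiring.Sum semiring
    using (sum; sum-cong-≋; ∑-distrib-+; *-distribˡ-sum; sum-replicate-zero)
  open import Data.Vec.Functional.Relation.Binary.Equality.Setoid setoid using (_≋_)
  open import Relation.Binary.Reasoning.Setoid setoid

  _⁻¹⟨_⟩ : ∀ x → ¬ x ≈ 0# → Carrier
  x ⁻¹⟨ x≉0 ⟩ = proj₁ (inverse x x≉0)

  x*x⁻¹≈1 : ∀ x (x≉0 : ¬ x ≈ 0#) → x * x ⁻¹⟨ x≉0 ⟩ ≈ 1#
  x*x⁻¹≈1 x x≉0 = proj₂ (inverse x x≉0)

  x⁻¹≉0 : ∀ x (x≉0 : ¬ x ≈ 0#) → ¬ x ⁻¹⟨ x≉0 ⟩ ≈ 0#
  x⁻¹≉0 x x≉0 x⁻¹≈0 = 1≉0 (begin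
    1#               ≈⟨ x*x⁻¹≈1 x x≉0 ⟨
    x * x ⁻¹⟨ x≉0 ⟩  ≈⟨ *-congˡ x⁻¹≈0 ⟩
    x * 0#           ≈⟨ zeroʳ x ⟩
    0#               ∎)

  *-cancelʳ-≉0 : ∀ {x y z} → ¬ z ≈ 0# → x * z ≈ y * z → x ≈ y
  *-cancelʳ-≉0 {x} {y} {z} z≉0 xz≈yz = begin
    x              ≈⟨ *-identityʳ x ⟨
    x * 1#         ≈⟨ *-congˡ (x*x⁻¹≈1 z z≉0) ⟨
    x * (z * z⁻¹)  ≈⟨ *-assoc x z z⁻¹ ⟨
    x * z * z⁻¹    ≈⟨ *-congʳ xz≈yz ⟩
    y * z * z⁻¹    ≈⟨ *-assoc y z z⁻¹ ⟩
    y * (z * z⁻¹)  ≈⟨ *-congˡ (x*x⁻¹≈1 z z≉0) ⟩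
    y * 1#         ≈⟨ *-identityʳ y ⟩
    y              ∎
    where
    z⁻¹ : Carrier
    z⁻¹ = z ⁻¹⟨ z≉0 ⟩

  x*y≈0⇒x≈0 : ∀ {x y} → ¬ y ≈ 0# → x * y ≈ 0# → x ≈ 0#
  x*y≈0⇒x≈0 {y = y} y≉0 xy≈0 = *-cancelʳ-≉0 y≉0 (trans xy≈0 (sym (zeroˡ y)))

  x*y≈0⇒y≈0 : ∀ {x y} → ¬ x ≈ 0# → x * y ≈ 0# → y ≈ 0#
  x*y≈0⇒y≈0 {x} {y} x≉0 xy≈0 = x*y≈0⇒x≈0 x≉0 (trans (*-comm y x) xy≈0)

  *-≉0 : ∀ {x y} → ¬ x ≈ 0# → ¬ y ≈ 0# → ¬ x * y ≈ 0#
  *-≉0 x≉0 y≉0 xy≈0 = x≉0 (x*y≈0⇒x≈0 y≉0 xy≈0)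

  [x-y]*z≈0⇒x≈y : ∀ {x y z} → ¬ z ≈ 0# → (x - y) * z ≈ 0# → x ≈ y
  [x-y]*z≈0⇒x≈y z≉0 eq = x∙y⁻¹≈ε⇒x≈y _ _ (x*y≈0⇒x≈0 z≉0 eq)

  -- Kernels of matrices and projective equivalence

  infix 7 _·_ _⊙_

  _⊙_ : ∀ {n} → (Fin n → Carrier) → (Fin n → Carrier) → Fin n → Carrier
  (x ⊙ y) j = x j * y j

  _·_ : ∀ {n} → (Fin n → Carrier) → (Fin n → Carrier) → Carrier
  x · y = sum (x ⊙ y)

  ·-scaleˡ : ∀ {n} a (r x : Fin n → Carrier) → (λ j → a * r j) · x ≈ a * (r · x)
  ·-scaleˡ a r x =
    trans (sum-cong-≋ λ j → *-assoc a (r j) (x j)) (sym (*-distribˡ-sum a (r ⊙ x)))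

  ·-scaleʳ : ∀ {n} a (r x : Fin n → Carrier) → r · (λ j → a * x j) ≈ a * (r · x)
  ·-scaleʳ a r x = trans (sum-cong-≋ λ j → swap (r j) (x j)) (sym (*-distribˡ-sum a (r ⊙ x)))
    where
    swap : ∀ y z → y * (a * z) ≈ a * (y * z)
    swap = solve 3 (λ a y z → y :* (a :* z) := a :* (y :* z)) refl a

  ·-addˡ : ∀ {n} a (r s x : Fin n → Carrier) →
           (λ j → r j + a * s j) · x ≈ r · x + a * (s · x)
  ·-addˡ a r s x = begin
    (λ j → r j + a * s j) · x                ≈⟨ sum-cong-≋ (λ j → expand (r j) (s j) (x j)) ⟩
    sum (λ j → r j * x j + a * (s j * x j))  ≈⟨ ∑-distrib-+ (r ⊙ x) (λ j → a * (s j * x j)) ⟩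
    r · x + sum (λ j → a * (s j * x j))      ≈⟨ +-congˡ (*-distribˡ-sum a (s ⊙ x)) ⟨
    r · x + a * (s · x)                      ∎
    where
    expand : ∀ y z w → (y + a * z) * w ≈ y * w + a * (z * w)
    expand = solve 4 (λ a y z w → (y :+ a :* z) :* w := y :* w :+ a :* (z :* w)) refl a

  ·-zeroˡ : ∀ {n} {r : Fin n → Carrier} x → (∀ j → r j ≈ 0#) → r · x ≈ 0#
  ·-zeroˡ {n} x r≈0 =
    trans (sum-cong-≋ λ j → trans (*-congʳ (r≈0 j)) (zeroˡ (x j))) (sum-replicate-zero n)

  InKernel : ∀ {m n} → Matrix Carrier m n → (Fin n → Carrier) → Set ℓ
  InKernel M x = ∀ i → M i · x ≈ 0#

  module _ {m n} (M : Matrix Carrier m n) where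

    kernel-rowwise : ∀ (N : Matrix Carrier m n) x y →
                     (∀ i → M i · x ≈ N i · y) → InKernel M x ⇔ InKernel N y
    kernel-rowwise N x y M≈N =
      mk⇔ (λ Mx i → trans (sym (M≈N i)) (Mx i)) (λ Ny i → trans (M≈N i) (Ny i))

    kernel-resp-≋ : ∀ x y → x ≋ y → InKernel M x ⇔ InKernel M y
    kernel-resp-≋ x y x≋y = kernel-rowwise M x y λ i → sum-cong-≋ λ j → *-congˡ (x≋y j)

    kernel-scale : ∀ x {a} → ¬ a ≈ 0# → InKernel M (λ j → a * x j) ⇔ InKernel M x
    kernel-scale x {a} a≉0 = mk⇔
      (λ Max i → x*y≈0⇒y≈0 a≉0 (trans (sym (·-scaleʳ a (M i) x)) (Max i)))
      (λ Mx i → trans (·-scaleʳ a (M i) x) (trans (*-congˡ (Mx i)) (zeroʳ a)))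

    kernel-rowSwap : ∀ x i j → InKernel M x ⇔ InKernel (λ k → M (swapIndex F i j k)) x
    kernel-rowSwap x i j = mk⇔
      (λ Mx k → Mx (swapIndex F i j k))
      (λ Nx k → ≡.subst (λ k → M k · x ≈ 0#) (swapIndex-surjective k) (Nx (transpose j i k)))
      where
      swapIndex≡transpose : ∀ k → swapIndex F i j k ≡ transpose i j k
      swapIndex≡transpose k with k ≟ i
      ... | yes _ = ≡.refl
      ... | no _ with k ≟ j
      ...   | yes _ = ≡.refl
      ...   | no _  = ≡.refl
      swapIndex-surjective : ∀ k → swapIndex F i j (transpose j i k) ≡ k
      swapIndex-surjective k =
        ≡.trans (swapIndex≡transpose (transpose j i k)) (transpose-inverse i j)

    kernel-rowScale : ∀ x i {a} → ¬ a ≈ 0# →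
                      InKernel M x ⇔ InKernel (rowScaleEntry F M i a) x
    kernel-rowScale x i {a} a≉0 = mk⇔ to from
      where
      to : InKernel M x → InKernel (rowScaleEntry F M i a) x
      to Mx k with k ≟ i
      ... | yes _ = trans (·-scaleˡ a (M k) x) (trans (*-congˡ (Mx k)) (zeroʳ a))
      ... | no _  = Mx k
      from : InKernel (rowScaleEntry F M i a) x → InKernel M x
      from Nx k with k ≟ i | Nx k
      ... | yes _ | aMk·x≈0 = x*y≈0⇒y≈0 a≉0 (trans (sym (·-scaleˡ a (M k) x)) aMk·x≈0)
      ... | no _  | Mk·x≈0  = Mk·x≈0

    kernel-rowAdd : ∀ x i j {a} → ¬ i ≡ j →
                    InKernel M x ⇔ InKernel (rowAddEntry F M i j a) x
    kernel-rowAdd x i j {a} i≢j = mk⇔ to from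
      where
      to : InKernel M x → InKernel (rowAddEntry F M i j a) x
      to Mx k with k ≟ i
      ... | yes _ = begin
        (λ l → M k l + a * M j l) · x  ≈⟨ ·-addˡ a (M k) (M j) x ⟩
        M k · x + a * (M j · x)        ≈⟨ +-cong (Mx k) (*-congˡ (Mx j)) ⟩
        0# + a * 0#                    ≈⟨ +-identityˡ _ ⟩
        a * 0#                         ≈⟨ zeroʳ a ⟩
        0#                             ∎
      ... | no _  = Mx k
      from : InKernel (rowAddEntry F M i j a) x → InKernel M x
      from Nx = kernel
        where
        Mj·x≈0 : M j · x ≈ 0#
        Mj·x≈0 with j ≟ i | Nx j
        ... | yes j≡i | _      = contradiction (≡.sym j≡i) i≢j
        ... | no _    | Mj·x≈0 = Mj·x≈0
        kernel : InKernel M x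
        kernel k with k ≟ i | Nx k
        ... | no _  | Mk·x≈0 = Mk·x≈0
        ... | yes _ | Nk·x≈0 = begin
          M k · x                        ≈⟨ +-identityʳ _ ⟨
          M k · x + 0#                   ≈⟨ +-congˡ (trans (*-congˡ Mj·x≈0) (zeroʳ a)) ⟨
          M k · x + a * (M j · x)        ≈⟨ ·-addˡ a (M k) (M j) x ⟨
          (λ l → M k l + a * M j l) · x  ≈⟨ Nk·x≈0 ⟩
          0#                             ∎

    kernel-adjoinZero : ∀ x i → InKernel M x ⇔ InKernel (insertAt M i (λ _ → 0#)) x
    kernel-adjoinZero x i = mk⇔
      (λ Mx → punchIn-cases i
        (≡.subst (λ r → r · x ≈ 0#) (≡.sym (insertAt-lookup M i _)) (·-zeroˡ x λ _ → refl))
        (λ k → ≡.subst (λ r → r · x ≈ 0#) (≡.sym (insertAt-punchIn M i _ k)) (Mx k)))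
      (λ Nx k → ≡.subst (λ r → r · x ≈ 0#) (insertAt-punchIn M i _ k) (Nx (punchIn i k)))

  kernel-deleteZero : ∀ {m n} (M : Matrix Carrier (suc m) n) x i →
                      (∀ l → M i l ≈ 0#) → InKernel M x ⇔ InKernel (removeAt M i) x
  kernel-deleteZero M x i Mi≈0 =
    mk⇔ (λ Mx k → Mx (punchIn i k)) (punchIn-cases i (·-zeroˡ x Mi≈0))

  colScaleVector : ∀ {n} → Fin n → Carrier → Fin n → Carrier
  colScaleVector j a l with l ≟ j
  ... | yes _ = a
  ... | no _  = 1#

  colScaleVector-≉0 : ∀ {n} (j : Fin n) {a} → ¬ a ≈ 0# → ∀ l → ¬ colScaleVector j a l ≈ 0#
  colScaleVector-≉0 j a≉0 l with l ≟ j
  ... | yes _ = a≉0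
  ... | no _  = 1≉0

  colScaleEntry-· : ∀ {m n} (M : Matrix Carrier m n) j a k x →
                    colScaleEntry F M j a k · x ≈ M k · (colScaleVector j a ⊙ x)
  colScaleEntry-· M j a k x = sum-cong-≋ pointwise
    where
    pointwise : ∀ l → colScaleEntry F M j a k l * x l ≈ M k l * (colScaleVector j a l * x l)
    pointwise l with l ≟ j
    ... | yes _ = solve 3 (λ a y z → a :* y :* z := y :* (a :* z)) refl a (M k l) (x l)
    ... | no _  = *-congˡ (sym (*-identityˡ (x l)))

  record KernelEquivalent {n} (A B : SizedMatrix F n) : Set (c ⊔ ℓ) where
    constructor kernelEquivalent
    field
      scaling   : Fin n → Carrier
      scaling≉0 : ∀ j → ¬ scaling j ≈ 0#
      kernel⇔   : ∀ x → InKernel (proj₂ B) x ⇔ InKernel (proj₂ A) (scaling ⊙ x)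

  sameKernel⇒kernelEquivalent : ∀ {m m′ n} {M : Matrix Carrier m n} {N : Matrix Carrier m′ n} →
    (∀ x → InKernel M x ⇔ InKernel N x) → KernelEquivalent (m , M) (m′ , N)
  sameKernel⇒kernelEquivalent {M = M} M⇔N = kernelEquivalent (λ _ → 1#) (λ _ → 1≉0) λ x →
    kernel-resp-≋ M x _ (λ j → sym (*-identityˡ (x j))) ⇔-∘ ⇔-sym (M⇔N x)

  module _ {n : ℕ} where

    kernelEquivalent-refl : Reflexive (KernelEquivalent {n})
    kernelEquivalent-refl = sameKernel⇒kernelEquivalent λ _ → ⇔-id _

    kernelEquivalent-sym : Symmetric (KernelEquivalent {n})
    kernelEquivalent-sym {_ , M} (kernelEquivalent d d≉0 N⇔M[d⊙]) =
      kernelEquivalent d⁻¹ (λ j → x⁻¹≉0 (d j) (d≉0 j)) λ x →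
        ⇔-sym (N⇔M[d⊙] (d⁻¹ ⊙ x)) ⇔-∘ kernel-resp-≋ M x _ (cancel x)
      where
      d⁻¹ : Fin n → Carrier
      d⁻¹ j = d j ⁻¹⟨ d≉0 j ⟩
      cancel : ∀ x → x ≋ d ⊙ (d⁻¹ ⊙ x)
      cancel x j = begin
        x j                  ≈⟨ *-identityˡ (x j) ⟨
        1# * x j             ≈⟨ *-congʳ (x*x⁻¹≈1 (d j) (d≉0 j)) ⟨
        d j * d⁻¹ j * x j    ≈⟨ *-assoc (d j) (d⁻¹ j) (x j) ⟩
        d j * (d⁻¹ j * x j)  ∎

    kernelEquivalent-trans : Transitive (KernelEquivalent {n})
    kernelEquivalent-trans {_ , M} (kernelEquivalent d d≉0 N⇔M[d⊙])
                                   (kernelEquivalent e e≉0 K⇔N[e⊙]) =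
      kernelEquivalent (d ⊙ e) (λ j → *-≉0 (d≉0 j) (e≉0 j)) λ x →
        kernel-resp-≋ M _ _ (λ j → sym (*-assoc (d j) (e j) (x j)))
          ⇔-∘ (N⇔M[d⊙] (e ⊙ x) ⇔-∘ K⇔N[e⊙] x)

    kernelEquivalent-isEquivalence : IsEquivalence (KernelEquivalent {n})
    kernelEquivalent-isEquivalence = record
      { refl  = kernelEquivalent-refl
      ; sym   = kernelEquivalent-sym
      ; trans = kernelEquivalent-trans
      }

    step⇒kernelEquivalent : Step F {n} ⇒ KernelEquivalent
    step⇒kernelEquivalent (same M N M≈N) = sameKernel⇒kernelEquivalent λ x →
      kernel-rowwise M N x x λ i → sum-cong-≋ λ j → *-congʳ (M≈N i j)
    step⇒kernelEquivalent (rowSwap M i j) =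
      sameKernel⇒kernelEquivalent λ x → kernel-rowSwap M x i j
    step⇒kernelEquivalent (rowScale M i a a≉0) =
      sameKernel⇒kernelEquivalent λ x → kernel-rowScale M x i a≉0
    step⇒kernelEquivalent (rowAdd M i j a i≢j) =
      sameKernel⇒kernelEquivalent λ x → kernel-rowAdd M x i j i≢j
    step⇒kernelEquivalent (colScale M j a a≉0) =
      kernelEquivalent (colScaleVector j a) (colScaleVector-≉0 j a≉0) λ x →
        kernel-rowwise _ M x _ λ k → colScaleEntry-· M j a k x
    step⇒kernelEquivalent (adjoinZero M i) =
      sameKernel⇒kernelEquivalent λ x → kernel-adjoinZero M x i
    step⇒kernelEquivalent (deleteZero M i Mi≈0) =
      sameKernel⇒kernelEquivalent λ x → kernel-deleteZero M x i Mi≈0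

  projectivelyEquivalent⇒kernelEquivalent :
    ∀ {m m′ n} {M : Matrix Carrier m n} {N : Matrix Carrier m′ n} →
    ProjectivelyEquivalent F M N → KernelEquivalent (m , M) (m′ , N)
  projectivelyEquivalent⇒kernelEquivalent =
    EqClosure.fold kernelEquivalent-isEquivalence step⇒kernelEquivalent

  kernel-constantScaling : ∀ {m n} (M : Matrix Carrier m n) x {d : Fin n → Carrier} {δ} →
                           (∀ j → d j ≈ δ) → ¬ δ ≈ 0# → InKernel M (d ⊙ x) ⇔ InKernel M x
  kernel-constantScaling M x d≈δ δ≉0 =
    kernel-scale M x δ≉0 ⇔-∘ kernel-resp-≋ M _ _ (λ j → *-congʳ (d≈δ j))

  -- Circulations and gains on 2C₄''

  netFlow : (Edge → Carrier) → Vertex → Carrier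
  netFlow x 0F = x 0F + x 1F - x 5F
  netFlow x 1F = x 2F - (x 0F + x 1F)
  netFlow x 2F = x 3F + x 4F - x 2F
  netFlow x 3F = x 5F - (x 3F + x 4F)

  IsCirculation : (Edge → Carrier) → Set ℓ
  IsCirculation x = ∀ v → netFlow x v ≈ 0#

  vertexEntry·≈netFlow : ∀ v x → vertexEntry F v · x ≈ netFlow x v
  vertexEntry·≈netFlow 0F x = solve 6 (λ x₀ x₁ x₂ x₃ x₄ x₅ →
    con 1ℤ :* x₀ :+ (con 1ℤ :* x₁ :+ (con 0ℤ :* x₂ :+
      (con 0ℤ :* x₃ :+ (con 0ℤ :* x₄ :+ (con -1ℤ :* x₅ :+ con 0ℤ)))))
    := x₀ :+ x₁ :- x₅) refl (x 0F) (x 1F) (x 2F) (x 3F) (x 4F) (x 5F)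
  vertexEntry·≈netFlow 1F x = solve 6 (λ x₀ x₁ x₂ x₃ x₄ x₅ →
    con -1ℤ :* x₀ :+ (con -1ℤ :* x₁ :+ (con 1ℤ :* x₂ :+
      (con 0ℤ :* x₃ :+ (con 0ℤ :* x₄ :+ (con 0ℤ :* x₅ :+ con 0ℤ)))))
    := x₂ :- (x₀ :+ x₁)) refl (x 0F) (x 1F) (x 2F) (x 3F) (x 4F) (x 5F)
  vertexEntry·≈netFlow 2F x = solve 6 (λ x₀ x₁ x₂ x₃ x₄ x₅ →
    con 0ℤ :* x₀ :+ (con 0ℤ :* x₁ :+ (con -1ℤ :* x₂ :+
      (con 1ℤ :* x₃ :+ (con 1ℤ :* x₄ :+ (con 0ℤ :* x₅ :+ con 0ℤ)))))
    := x₃ :+ x₄ :- x₂) refl (x 0F) (x 1F) (x 2F) (x 3F) (x 4F) (x 5F)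
  vertexEntry·≈netFlow 3F x = solve 6 (λ x₀ x₁ x₂ x₃ x₄ x₅ →
    con 0ℤ :* x₀ :+ (con 0ℤ :* x₁ :+ (con 0ℤ :* x₂ :+
      (con -1ℤ :* x₃ :+ (con -1ℤ :* x₄ :+ (con 1ℤ :* x₅ :+ con 0ℤ)))))
    := x₅ :- (x₃ :+ x₄)) refl (x 0F) (x 1F) (x 2F) (x 3F) (x 4F) (x 5F)

  kernel-liftMatrix : ∀ φ x → InKernel (liftMatrix F φ) x ⇔ (IsCirculation x × φ · x ≈ 0#)
  kernel-liftMatrix φ x = mk⇔ (λ Ax → circulation Ax , Ax 4F) (λ (circ , gain) → kernel circ gain)
    where
    circulation : InKernel (liftMatrix F φ) x → IsCirculation x
    circulation Ax 0F = trans (sym (vertexEntry·≈netFlow 0F x)) (Ax 0F)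
    circulation Ax 1F = trans (sym (vertexEntry·≈netFlow 1F x)) (Ax 1F)
    circulation Ax 2F = trans (sym (vertexEntry·≈netFlow 2F x)) (Ax 2F)
    circulation Ax 3F = trans (sym (vertexEntry·≈netFlow 3F x)) (Ax 3F)
    kernel : IsCirculation x → φ · x ≈ 0# → InKernel (liftMatrix F φ) x
    kernel circ gain 0F = trans (vertexEntry·≈netFlow 0F x) (circ 0F)
    kernel circ gain 1F = trans (vertexEntry·≈netFlow 1F x) (circ 1F)
    kernel circ gain 2F = trans (vertexEntry·≈netFlow 2F x) (circ 2F)
    kernel circ gain 3F = trans (vertexEntry·≈netFlow 3F x) (circ 3F)
    kernel circ gain 4F = gain

  -- α (e₀ − e₁) + β (e₃ − e₄) + γ (e₀ + e₂ + e₃ + e₅), the general circulation on 2C₄''.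
  cycleCombination : Carrier → Carrier → Carrier → Edge → Carrier
  cycleCombination α β γ 0F = α + γ
  cycleCombination α β γ 1F = - α
  cycleCombination α β γ 2F = γ
  cycleCombination α β γ 3F = β + γ
  cycleCombination α β γ 4F = - β
  cycleCombination α β γ 5F = γ

  gain₁ gain₂ gain₃ : GainFunction F → Carrier
  gain₁ φ = φ 0F - φ 1F
  gain₂ φ = φ 3F - φ 4F
  gain₃ φ = φ 0F + φ 2F + φ 3F + φ 5F

  cycleCombination-isCirculation : ∀ α β γ → IsCirculation (cycleCombination α β γ)
  cycleCombination-isCirculation α β γ 0F =
    solve 3 (λ α β γ → α :+ γ :+ :- α :- γ := con 0ℤ) refl α β γ
  cycleCombination-isCirculation α β γ 1F =
    solve 3 (λ α β γ → γ :- (α :+ γ :+ :- α) := con 0ℤ) refl α β γ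
  cycleCombination-isCirculation α β γ 2F =
    solve 3 (λ α β γ → β :+ γ :+ :- β :- γ := con 0ℤ) refl α β γ
  cycleCombination-isCirculation α β γ 3F =
    solve 3 (λ α β γ → γ :- (β :+ γ :+ :- β) := con 0ℤ) refl α β γ

  ·-cycleCombination : ∀ φ α β γ →
                       φ · cycleCombination α β γ ≈ α * gain₁ φ + β * gain₂ φ + γ * gain₃ φ
  ·-cycleCombination φ α β γ = solve 9 (λ α β γ φ₀ φ₁ φ₂ φ₃ φ₄ φ₅ →
    φ₀ :* (α :+ γ) :+ (φ₁ :* :- α :+ (φ₂ :* γ :+
      (φ₃ :* (β :+ γ) :+ (φ₄ :* :- β :+ (φ₅ :* γ :+ con 0ℤ)))))
    := α :* (φ₀ :- φ₁) :+ β :* (φ₃ :- φ₄) :+ γ :* (φ₀ :+ φ₂ :+ φ₃ :+ φ₅))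
    refl α β γ (φ 0F) (φ 1F) (φ 2F) (φ 3F) (φ 4F) (φ 5F)

  cycleCombination-kernel : ∀ φ α β γ →
    InKernel (liftMatrix F φ) (cycleCombination α β γ)
      ⇔ (α * gain₁ φ + β * gain₂ φ + γ * gain₃ φ ≈ 0#)
  cycleCombination-kernel φ α β γ = mk⇔
    (λ Ax → trans (sym (·-cycleCombination φ α β γ)) (proj₂ (Equivalence.to lift⇔ Ax)))
    (λ gain≈0 → Equivalence.from lift⇔
      (cycleCombination-isCirculation α β γ , trans (·-cycleCombination φ α β γ) gain≈0))
    where
    lift⇔ : InKernel (liftMatrix F φ) (cycleCombination α β γ)
              ⇔ (IsCirculation (cycleCombination α β γ) × φ · cycleCombination α β γ ≈ 0#)
    lift⇔ = kernel-liftMatrix φ (cycleCombination α β γ)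

  kernelVector₁ kernelVector₂ : GainFunction F → Edge → Carrier
  kernelVector₁ φ = cycleCombination (gain₂ φ) (- gain₁ φ) 0#
  kernelVector₂ φ = cycleCombination (- gain₃ φ) 0# (gain₁ φ)

  kernelVector₁-kernel : ∀ φ → InKernel (liftMatrix F φ) (kernelVector₁ φ)
  kernelVector₁-kernel φ = Equivalence.from (cycleCombination-kernel φ _ _ _)
    (solve 3 (λ g₁ g₂ g₃ → g₂ :* g₁ :+ :- g₁ :* g₂ :+ con 0ℤ :* g₃ := con 0ℤ)
      refl (gain₁ φ) (gain₂ φ) (gain₃ φ))

  kernelVector₂-kernel : ∀ φ → InKernel (liftMatrix F φ) (kernelVector₂ φ)
  kernelVector₂-kernel φ = Equivalence.from (cycleCombination-kernel φ _ _ _)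
    (solve 3 (λ g₁ g₂ g₃ → :- g₃ :* g₁ :+ con 0ℤ :* g₂ :+ g₁ :* g₃ := con 0ℤ)
      refl (gain₁ φ) (gain₂ φ) (gain₃ φ))

  -- Each vertex equation of d ⊙ kernelVectorᵢ forces two entries of d to agree.
  circulationScaling-constant : ∀ φ (d : Edge → Carrier) → NoBalanced2Cycle F φ →
    IsCirculation (d ⊙ kernelVector₁ φ) → IsCirculation (d ⊙ kernelVector₂ φ) →
    ∀ e → d e ≈ d 0F
  circulationScaling-constant φ d (g₁≉0 , g₂≉0) U W = d≈d₀
    where
    g₁ g₃ : Carrier
    g₁ = gain₁ φ
    g₃ = gain₃ φ
    d₀≈d₁ : d 0F ≈ d 1F
    d₀≈d₁ = [x-y]*z≈0⇒x≈y g₂≉0 (trans (solve 4 (λ d₀ d₁ d₅ g₂ →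
      (d₀ :- d₁) :* g₂ := d₀ :* (g₂ :+ con 0ℤ) :+ d₁ :* :- g₂ :- d₅ :* con 0ℤ)
      refl (d 0F) (d 1F) (d 5F) (gain₂ φ)) (U 0F))
    d₄≈d₃ : d 4F ≈ d 3F
    d₄≈d₃ = [x-y]*z≈0⇒x≈y g₁≉0 (trans (solve 4 (λ d₂ d₃ d₄ g₁ →
      (d₄ :- d₃) :* g₁ := d₃ :* (:- g₁ :+ con 0ℤ) :+ d₄ :* :- :- g₁ :- d₂ :* con 0ℤ)
      refl (d 2F) (d 3F) (d 4F) g₁) (U 2F))
    d₀≈d₅ : d 0F ≈ d 5F
    d₀≈d₅ = [x-y]*z≈0⇒x≈y g₁≉0 (begin
      (d 0F - d 5F) * g₁
        ≈⟨ solve 5 (λ d₀ d₁ d₅ g₁ g₃ → (d₀ :- d₅) :* g₁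
             := d₀ :* (:- g₃ :+ g₁) :+ d₁ :* :- :- g₃ :- d₅ :* g₁ :+ (d₀ :- d₁) :* g₃)
           refl (d 0F) (d 1F) (d 5F) g₁ g₃ ⟩
      netFlow (d ⊙ kernelVector₂ φ) 0F + (d 0F - d 1F) * g₃
        ≈⟨ +-cong (W 0F) (*-congʳ (x≈y⇒x∙y⁻¹≈ε d₀≈d₁)) ⟩
      0# + 0# * g₃
        ≈⟨ trans (+-identityˡ _) (zeroˡ g₃) ⟩
      0# ∎)
    d₃≈d₂ : d 3F ≈ d 2F
    d₃≈d₂ = [x-y]*z≈0⇒x≈y g₁≉0 (trans (solve 4 (λ d₂ d₃ d₄ g₁ →
      (d₃ :- d₂) :* g₁ := d₃ :* (con 0ℤ :+ g₁) :+ d₄ :* :- con 0ℤ :- d₂ :* g₁)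
      refl (d 2F) (d 3F) (d 4F) g₁) (W 2F))
    d₅≈d₃ : d 5F ≈ d 3F
    d₅≈d₃ = [x-y]*z≈0⇒x≈y g₁≉0 (trans (solve 4 (λ d₃ d₄ d₅ g₁ →
      (d₅ :- d₃) :* g₁ := d₅ :* g₁ :- (d₃ :* (con 0ℤ :+ g₁) :+ d₄ :* :- con 0ℤ))
      refl (d 3F) (d 4F) (d 5F) g₁) (W 3F))
    d≈d₀ : ∀ e → d e ≈ d 0F
    d≈d₀ 0F = refl
    d≈d₀ 1F = sym d₀≈d₁
    d≈d₀ 2F = trans (sym d₃≈d₂) (d≈d₀ 3F)
    d≈d₀ 3F = trans (sym d₅≈d₃) (sym d₀≈d₅)
    d≈d₀ 4F = trans d₄≈d₃ (d≈d₀ 3F)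
    d≈d₀ 5F = sym d₀≈d₅

  kernelEquivalent⇒sameKernel : ∀ φ ψ → NoBalanced2Cycle F φ →
    KernelEquivalent (5 , liftMatrix F φ) (5 , liftMatrix F ψ) →
    ∀ x → InKernel (liftMatrix F φ) x ⇔ InKernel (liftMatrix F ψ) x
  kernelEquivalent⇒sameKernel φ ψ unbalanced φ∼ψ x =
    kernel-constantScaling (liftMatrix F ψ) x d≈d₀ (d≉0 0F) ⇔-∘ φ⇔ψ[d⊙] x
    where
    open KernelEquivalent (kernelEquivalent-sym φ∼ψ)
      renaming (scaling to d; scaling≉0 to d≉0; kernel⇔ to φ⇔ψ[d⊙])
    circulation : ∀ y → InKernel (liftMatrix F φ) y → IsCirculation (d ⊙ y)
    circulation y =
      proj₁ ∘ Equivalence.to (kernel-liftMatrix ψ (d ⊙ y)) ∘ Equivalence.to (φ⇔ψ[d⊙] y)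
    d≈d₀ : ∀ e → d e ≈ d 0F
    d≈d₀ = circulationScaling-constant φ d unbalanced
      (circulation (kernelVector₁ φ) (kernelVector₁-kernel φ))
      (circulation (kernelVector₂ φ) (kernelVector₂-kernel φ))

  -- Switching and scaling

  minors⇒proportional : ∀ {g₁ g₂ g₃ h₁ h₂ h₃} → ¬ g₁ ≈ 0# →
    h₂ * g₁ ≈ h₁ * g₂ → h₃ * g₁ ≈ h₁ * g₃ →
    Σ Carrier λ a → h₁ ≈ a * g₁ × h₂ ≈ a * g₂ × h₃ ≈ a * g₃
  minors⇒proportional {g₁} {h₁ = h₁} g₁≉0 minor₂ minor₃ =
    a , proportional refl , proportional minor₂ , proportional minor₃
    where
    g₁⁻¹ a : Carrier
    g₁⁻¹ = g₁ ⁻¹⟨ g₁≉0 ⟩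
    a = h₁ * g₁⁻¹
    proportional : ∀ {g h} → h * g₁ ≈ h₁ * g → h ≈ a * g
    proportional {g} {h} minor = *-cancelʳ-≉0 g₁≉0 (begin
      h * g₁                ≈⟨ minor ⟩
      h₁ * g                ≈⟨ *-identityʳ _ ⟨
      h₁ * g * 1#           ≈⟨ *-congˡ (x*x⁻¹≈1 g₁ g₁≉0) ⟨
      h₁ * g * (g₁ * g₁⁻¹)  ≈⟨ solve 4 (λ h₁ g g₁ g₁⁻¹ →
                                  h₁ :* g :* (g₁ :* g₁⁻¹) := h₁ :* g₁⁻¹ :* g :* g₁)
                                refl h₁ g g₁ g₁⁻¹ ⟩
      a * g * g₁            ∎)

  -- The sum of r along the spanning path e₀ e₂ e₃ starting at v₁.
  potential : GainFunction F → Vertex → Carrier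
  potential r 0F = 0#
  potential r 1F = r 0F
  potential r 2F = r 0F + r 2F
  potential r 3F = r 0F + r 2F + r 3F

  balanced⇒coboundary : ∀ r → gain₁ r ≈ 0# → gain₂ r ≈ 0# → gain₃ r ≈ 0# →
                        ∀ e → r e ≈ potential r (head e) - potential r (tail e)
  balanced⇒coboundary r balanced₁ balanced₂ balanced₃ = coboundary
    where
    coboundary : ∀ e → r e ≈ potential r (head e) - potential r (tail e)
    coboundary 0F = solve 1 (λ r₀ → r₀ := r₀ :- con 0ℤ) refl (r 0F)
    coboundary 1F = trans (sym (x∙y⁻¹≈ε⇒x≈y _ _ balanced₁)) (coboundary 0F)
    coboundary 2F = solve 2 (λ r₀ r₂ → r₂ := r₀ :+ r₂ :- r₀) refl (r 0F) (r 2F)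
    coboundary 3F = solve 3 (λ r₀ r₂ r₃ → r₃ := r₀ :+ r₂ :+ r₃ :- (r₀ :+ r₂))
                      refl (r 0F) (r 2F) (r 3F)
    coboundary 4F = trans (sym (x∙y⁻¹≈ε⇒x≈y _ _ balanced₂)) (coboundary 3F)
    coboundary 5F = begin
      r 5F                                 ≈⟨ solve 4 (λ r₀ r₂ r₃ r₅ → r₅
                                                := con 0ℤ :- (r₀ :+ r₂ :+ r₃) :+ (r₀ :+ r₂ :+ r₃ :+ r₅))
                                              refl (r 0F) (r 2F) (r 3F) (r 5F) ⟩
      0# - (r 0F + r 2F + r 3F) + gain₃ r  ≈⟨ +-congˡ balanced₃ ⟩
      0# - (r 0F + r 2F + r 3F) + 0#       ≈⟨ +-identityʳ _ ⟩
      0# - (r 0F + r 2F + r 3F)            ∎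

  *-switch : ∀ {a} (a≉0 : ¬ a ≈ 0#) (η : Vertex → Carrier) φ e →
             a * switch F (λ v → a ⁻¹⟨ a≉0 ⟩ * η v) φ e ≈ η (head e) - η (tail e) + a * φ e
  *-switch {a} a≉0 η φ e = begin
    a * (- (a⁻¹ * η (tail e)) + φ e + a⁻¹ * η (head e))
      ≈⟨ solve 5 (λ a a⁻¹ t h p →
           a :* (:- (a⁻¹ :* t) :+ p :+ a⁻¹ :* h) := a :* a⁻¹ :* (h :- t) :+ a :* p)
         refl a a⁻¹ (η (tail e)) (η (head e)) (φ e) ⟩
    a * a⁻¹ * (η (head e) - η (tail e)) + a * φ e
      ≈⟨ +-congʳ (trans (*-congʳ (x*x⁻¹≈1 a a≉0)) (*-identityˡ _)) ⟩
    η (head e) - η (tail e) + a * φ e ∎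
    where
    a⁻¹ : Carrier
    a⁻¹ = a ⁻¹⟨ a≉0 ⟩

  proportionalGains⇒switchScaleEquivalent : ∀ φ ψ {a} → ¬ a ≈ 0# →
    gain₁ ψ ≈ a * gain₁ φ → gain₂ ψ ≈ a * gain₂ φ → gain₃ ψ ≈ a * gain₃ φ →
    SwitchScaleEquivalent F φ ψ
  proportionalGains⇒switchScaleEquivalent φ ψ {a} a≉0 ψ₁≈aφ₁ ψ₂≈aφ₂ ψ₃≈aφ₃ =
    (λ v → a ⁻¹⟨ a≉0 ⟩ * η v) , a , a≉0 , λ e → begin
      ψ e                                         ≈⟨ solve 3 (λ s a p → s := s :- a :* p :+ a :* p)
                                                       refl (ψ e) a (φ e) ⟩
      r e + a * φ e                               ≈⟨ +-congʳ (balanced⇒coboundary r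
                                                       balanced₁ balanced₂ balanced₃ e) ⟩
      η (head e) - η (tail e) + a * φ e           ≈⟨ *-switch a≉0 η φ e ⟨
      a * switch F (λ v → a ⁻¹⟨ a≉0 ⟩ * η v) φ e  ∎
    where
    r : GainFunction F
    r e = ψ e - a * φ e
    η : Vertex → Carrier
    η = potential r
    balanced₁ : gain₁ r ≈ 0#
    balanced₁ = trans
      (solve 5 (λ a s₀ s₁ p₀ p₁ → s₀ :- a :* p₀ :- (s₁ :- a :* p₁) := s₀ :- s₁ :- a :* (p₀ :- p₁))
        refl a (ψ 0F) (ψ 1F) (φ 0F) (φ 1F))
      (x≈y⇒x∙y⁻¹≈ε ψ₁≈aφ₁)
    balanced₂ : gain₂ r ≈ 0#
    balanced₂ = trans
      (solve 5 (λ a s₃ s₄ p₃ p₄ → s₃ :- a :* p₃ :- (s₄ :- a :* p₄) := s₃ :- s₄ :- a :* (p₃ :- p₄))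
        refl a (ψ 3F) (ψ 4F) (φ 3F) (φ 4F))
      (x≈y⇒x∙y⁻¹≈ε ψ₂≈aφ₂)
    balanced₃ : gain₃ r ≈ 0#
    balanced₃ = trans
      (solve 9 (λ a s₀ s₂ s₃ s₅ p₀ p₂ p₃ p₅ →
          s₀ :- a :* p₀ :+ (s₂ :- a :* p₂) :+ (s₃ :- a :* p₃) :+ (s₅ :- a :* p₅)
          := s₀ :+ s₂ :+ s₃ :+ s₅ :- a :* (p₀ :+ p₂ :+ p₃ :+ p₅))
        refl a (ψ 0F) (ψ 2F) (ψ 3F) (ψ 5F) (φ 0F) (φ 2F) (φ 3F) (φ 5F))
      (x≈y⇒x∙y⁻¹≈ε ψ₃≈aφ₃)

  sameKernel⇒switchScaleEquivalent : ∀ φ ψ → NoBalanced2Cycle F φ →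
    (∀ x → InKernel (liftMatrix F φ) x ⇔ InKernel (liftMatrix F ψ) x) →
    SwitchScaleEquivalent F φ ψ
  sameKernel⇒switchScaleEquivalent φ ψ (g₁≉0 , _) φ⇔ψ =
    let a , h₁≈ag₁ , h₂≈ag₂ , h₃≈ag₃ = minors⇒proportional g₁≉0 minor₂ minor₃
        a≉0 : ¬ a ≈ 0#
        a≉0 a≈0 = h₁≉0 (trans h₁≈ag₁ (trans (*-congʳ a≈0) (zeroˡ g₁)))
    in proportionalGains⇒switchScaleEquivalent φ ψ a≉0 h₁≈ag₁ h₂≈ag₂ h₃≈ag₃
    where
    g₁ g₂ g₃ h₁ h₂ h₃ : Carrier
    g₁ = gain₁ φ
    g₂ = gain₂ φ
    g₃ = gain₃ φ
    h₁ = gain₁ ψ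
    h₂ = gain₂ ψ
    h₃ = gain₃ ψ
    ψ-gain : ∀ α β γ → α * g₁ + β * g₂ + γ * g₃ ≈ 0# → α * h₁ + β * h₂ + γ * h₃ ≈ 0#
    ψ-gain α β γ = Equivalence.to (cycleCombination-kernel ψ α β γ)
                 ∘ Equivalence.to (φ⇔ψ (cycleCombination α β γ))
                 ∘ Equivalence.from (cycleCombination-kernel φ α β γ)
    φ-gain : ∀ α β γ → α * h₁ + β * h₂ + γ * h₃ ≈ 0# → α * g₁ + β * g₂ + γ * g₃ ≈ 0#
    φ-gain α β γ = Equivalence.to (cycleCombination-kernel φ α β γ)
                 ∘ Equivalence.from (φ⇔ψ (cycleCombination α β γ))
                 ∘ Equivalence.from (cycleCombination-kernel ψ α β γ)
    minor₂ : h₂ * g₁ ≈ h₁ * g₂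
    minor₂ = sym (x∙y⁻¹≈ε⇒x≈y _ _ (trans
      (solve 6 (λ g₁ g₂ g₃ h₁ h₂ h₃ →
          h₁ :* g₂ :- h₂ :* g₁ := g₂ :* h₁ :+ :- g₁ :* h₂ :+ con 0ℤ :* h₃)
        refl g₁ g₂ g₃ h₁ h₂ h₃)
      (ψ-gain _ _ _ (Equivalence.to (cycleCombination-kernel φ _ _ _) (kernelVector₁-kernel φ)))))
    minor₃ : h₃ * g₁ ≈ h₁ * g₃
    minor₃ = x∙y⁻¹≈ε⇒x≈y _ _ (trans
      (solve 6 (λ g₁ g₂ g₃ h₁ h₂ h₃ →
          h₃ :* g₁ :- h₁ :* g₃ := :- g₃ :* h₁ :+ con 0ℤ :* h₂ :+ g₁ :* h₃)
        refl g₁ g₂ g₃ h₁ h₂ h₃)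
      (ψ-gain _ _ _ (Equivalence.to (cycleCombination-kernel φ _ _ _) (kernelVector₂-kernel φ))))
    1x+0y+0z≈x : ∀ x y z → 1# * x + 0# * y + 0# * z ≈ x
    1x+0y+0z≈x = solve 3 (λ x y z → con 1ℤ :* x :+ con 0ℤ :* y :+ con 0ℤ :* z := x) refl
    h₁≉0 : ¬ h₁ ≈ 0#
    h₁≉0 h₁≈0 = g₁≉0 (trans (sym (1x+0y+0z≈x g₁ g₂ g₃))
      (φ-gain 1# 0# 0# (trans (1x+0y+0z≈x h₁ h₂ h₃) h₁≈0)))

  switch-by-vertexRows : ∀ (η : Vertex → Carrier) φ e →
    φ e + - η 0F * vertexEntry F 0F e + - η 1F * vertexEntry F 1F e
        + - η 2F * vertexEntry F 2F e + - η 3F * vertexEntry F 3F e ≈ switch F η φ e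
  switch-by-vertexRows η φ 0F = solve 5 (λ p n₀ n₁ n₂ n₃ →
    p :+ :- n₀ :* con 1ℤ :+ :- n₁ :* con -1ℤ :+ :- n₂ :* con 0ℤ :+ :- n₃ :* con 0ℤ
    := :- n₀ :+ p :+ n₁) refl (φ 0F) (η 0F) (η 1F) (η 2F) (η 3F)
  switch-by-vertexRows η φ 1F = solve 5 (λ p n₀ n₁ n₂ n₃ →
    p :+ :- n₀ :* con 1ℤ :+ :- n₁ :* con -1ℤ :+ :- n₂ :* con 0ℤ :+ :- n₃ :* con 0ℤ
    := :- n₀ :+ p :+ n₁) refl (φ 1F) (η 0F) (η 1F) (η 2F) (η 3F)
  switch-by-vertexRows η φ 2F = solve 5 (λ p n₀ n₁ n₂ n₃ →
    p :+ :- n₀ :* con 0ℤ :+ :- n₁ :* con 1ℤ :+ :- n₂ :* con -1ℤ :+ :- n₃ :* con 0ℤ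
    := :- n₁ :+ p :+ n₂) refl (φ 2F) (η 0F) (η 1F) (η 2F) (η 3F)
  switch-by-vertexRows η φ 3F = solve 5 (λ p n₀ n₁ n₂ n₃ →
    p :+ :- n₀ :* con 0ℤ :+ :- n₁ :* con 0ℤ :+ :- n₂ :* con 1ℤ :+ :- n₃ :* con -1ℤ
    := :- n₂ :+ p :+ n₃) refl (φ 3F) (η 0F) (η 1F) (η 2F) (η 3F)
  switch-by-vertexRows η φ 4F = solve 5 (λ p n₀ n₁ n₂ n₃ →
    p :+ :- n₀ :* con 0ℤ :+ :- n₁ :* con 0ℤ :+ :- n₂ :* con 1ℤ :+ :- n₃ :* con -1ℤ
    := :- n₂ :+ p :+ n₃) refl (φ 4F) (η 0F) (η 1F) (η 2F) (η 3F)
  switch-by-vertexRows η φ 5F = solve 5 (λ p n₀ n₁ n₂ n₃ →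
    p :+ :- n₀ :* con -1ℤ :+ :- n₁ :* con 0ℤ :+ :- n₂ :* con 0ℤ :+ :- n₃ :* con 1ℤ
    := :- n₃ :+ p :+ n₀) refl (φ 5F) (η 0F) (η 1F) (η 2F) (η 3F)

  liftMatrix-cong : ∀ {φ ψ} → (∀ e → φ e ≈ ψ e) →
                    ProjectivelyEquivalent F (liftMatrix F φ) (liftMatrix F ψ)
  liftMatrix-cong φ≈ψ =
    fwd (same _ _ λ { 0F _ → refl ; 1F _ → refl ; 2F _ → refl ; 3F _ → refl ; 4F e → φ≈ψ e })
      ◅ ε

  liftMatrix-scale : ∀ φ {a} → ¬ a ≈ 0# →
                     ProjectivelyEquivalent F (liftMatrix F φ) (liftMatrix F (λ e → a * φ e))
  liftMatrix-scale φ {a} a≉0 = fwd (rowScale _ 4F a a≉0) ◅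
    fwd (same _ _ λ { 0F _ → refl ; 1F _ → refl ; 2F _ → refl ; 3F _ → refl ; 4F _ → refl })
      ◅ ε

  liftMatrix-switch : ∀ η φ →
                      ProjectivelyEquivalent F (liftMatrix F φ) (liftMatrix F (switch F η φ))
  liftMatrix-switch η φ =
    fwd (rowAdd _ 4F 0F (- η 0F) λ ()) ◅ fwd (rowAdd _ 4F 1F (- η 1F) λ ()) ◅
    fwd (rowAdd _ 4F 2F (- η 2F) λ ()) ◅ fwd (rowAdd _ 4F 3F (- η 3F) λ ()) ◅
    fwd (same _ _ λ { 0F _ → refl ; 1F _ → refl ; 2F _ → refl ; 3F _ → refl
                    ; 4F e → switch-by-vertexRows η φ e }) ◅ ε

  switchScaleEquivalent⇒projectivelyEquivalent : ∀ φ ψ → SwitchScaleEquivalent F φ ψ →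
    ProjectivelyEquivalent F (liftMatrix F φ) (liftMatrix F ψ)
  switchScaleEquivalent⇒projectivelyEquivalent φ ψ (η , a , a≉0 , ψ≈aφ^η) =
    liftMatrix-switch η φ ◅◅ liftMatrix-scale (switch F η φ) a≉0 ◅◅ liftMatrix-cong (sym ∘ ψ≈aφ^η)

mainTheorem15 : ∀ {c ℓ : Level} (F : Field c ℓ) (φ ψ : GainFunction F) →
    NoBalanced2Cycle F φ →
    (ProjectivelyEquivalent F (liftMatrix F φ) (liftMatrix F ψ) ⇔ SwitchScaleEquivalent F φ ψ)
mainTheorem15 F φ ψ unbalanced = mk⇔
  ( sameKernel⇒switchScaleEquivalent F φ ψ unbalanced
  ∘ kernelEquivalent⇒sameKernel F φ ψ unbalanced
  ∘ projectivelyEquivalent⇒kernelEquivalent F)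
  (switchScaleEquivalent⇒projectivelyEquivalent F φ ψ)
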